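{- Let $n\geq 2$ and let $l=3^m l_1$ be a positive integer with $l_1\geq 2$, $\gcd(3,l_1)=1$ and $m\geq 0$. Then $$\varepsilon_2(n,l)=\begin{cases} n^{3l}-n^l-\pi_n(3l) & \text{if } l_1 \text{ is odd},\\ n^{3l}-n^l-\pi_n(3l)-\pi_n\!\left(\frac{3l}{2}\right) & \text{if } l_1 \text{ is even}.\end{cases}$$
   Context: A nonempty word $u$ is primitive if $u=v^m$ with $m$ a positive integer implies $m=1$; $|u|$ is the length of $u$. $\pi_n(k)$ denotes the number of primitive words of length $k$ over an alphabet of size $n$. For an alphabet $\mathcal{A}$ of size $n$, let $\mathcal{E}(\mathcal{A},l)$ be the set of pairs $(p,q)$ of primitive words over $\mathcal{A}$ with $|p|=2|q|=2l$ and $pq$ not primitive, and let $\mathcal{E}_2(\mathcal{A},l)$ be the set of those $(p,q)\in\mathcal{E}(\mathcal{A},l)$ for which there exist nonempty words $\alpha,\beta$ and an integer $s\geq1$ with $\alpha\beta$ primitive, $q=(\alpha\beta)^s\alpha$, and either ($p=(\beta\alpha)^{2s}\beta$ and $|\beta|=2|\alpha|$) or ($p=(\beta\alpha)^{2s+1}\beta$ and $|\alpha|=2|\beta|$). $\varepsilon_2(n,l)=|\mathcal{E}_2(\mathcal{A},l)|$. -}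

module Defs where

open import Data.Nat using (ℕ; suc; _+_; _*_; _≤_)
open import Data.Fin using (Fin)
open import Data.List using (List; []; _++_; length; concat; replicate)
open import Data.List.Membership.Propositional using (_∈_)
open import Data.List.Relation.Unary.Unique.Propositional using (Unique)
open import Data.Product using (Σ; _×_; _,_; ∃-syntax)
open import Data.Sum using (_⊎_)
open import Relation.Nullary using (¬_)
open import Relation.Binary.PropositionalEquality using (_≡_; _≢_)
open import Function.Bundles using (_⇔_)

Word : ℕ → Set
Word n = List (Fin n)

_^ʷ_ : ∀ {n} → Word n → ℕ → Word n
v ^ʷ m = concat (replicate m v)

Primitive : ∀ {n} → Word n → Set
Primitive {n} u = (u ≢ []) × (∀ (v : Word n) (m : ℕ) → 1 ≤ m → u ≡ v ^ʷ m → m ≡ 1)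

PrimOfLength : (n k : ℕ) → Word n → Set
PrimOfLength n k u = Primitive u × length u ≡ k

IsCard : {A : Set} → (A → Set) → ℕ → Set
IsCard {A} P k = Σ (List A) λ xs → Unique xs × (∀ x → (x ∈ xs) ⇔ P x) × length xs ≡ k

InE : (n l : ℕ) → Word n × Word n → Set
InE n l (p , q) = Primitive p × Primitive q × length p ≡ 2 * l × length q ≡ l × ¬ Primitive (p ++ q)

InE₂ : (n l : ℕ) → Word n × Word n → Set
InE₂ n l (p , q) =
  InE n l (p , q) ×
  ∃[ α ] ∃[ β ] ∃[ s ]
    ( α ≢ [] × β ≢ [] × 1 ≤ s × Primitive (α ++ β)
    × q ≡ ((α ++ β) ^ʷ s) ++ α
    × ( (p ≡ ((β ++ α) ^ʷ (2 * s)) ++ β × length β ≡ 2 * length α)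
      ⊎ (p ≡ ((β ++ α) ^ʷ (2 * s + 1)) ++ β × length α ≡ 2 * length β)))

-- Cut a word w of length 3l as w = pq with |p| = 2l and |q| = l.  This is a bijection from the words of
-- length 3l that are neither primitive, nor cubes, nor squares of primitive words onto 𝓔₂(𝒜, l).
-- Indeed such a w is z^K with z primitive, 3 ∤ K (w is no cube) and K ≠ 2, hence 3 ∣ |z|.  Writing
-- z = βα with |β| = 2|α| when K = 3s + 1 and |α| = 2|β| when K = 3s + 2 gives p = (βα)^t β and
-- q = (αβ)^s α, both primitive by the Fine–Wilf theorem; for s = 1 this uses the exact ratio
-- |αβ| : |q| = 3 : 4 or 3 : 5.  Conversely, for (p, q) ∈ 𝓔₂ the word pq is (βα)^K with 3 ∤ K > 2, and
-- as the exponent of a primitive root is divisible by the exponent of any other root (Fine–Wilf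
-- again), pq is neither a cube nor the square of a primitive word.  The count follows by removing
-- from the n^{3l} words the n^l cubes, the π_n(3l) primitive words and, when 3l is even, the
-- π_n(3l/2) squares of primitive words, three pairwise disjoint sets.

module Submission where

open import Defs
open import Data.Nat using (ℕ; zero; suc; _+_; _*_; _∸_; _≤_; _<_; _^_; s≤s; z≤n; _/_; _%_; NonZero; >-nonZero)
open import Data.Nat.Properties
open import Data.Nat.Divisibility
open import Data.Nat.DivMod using (m≡m%n+[m/n]*n; m%n<n; m*n%n≡0; %-distribˡ-*; m/n*n≡m)
open import Data.Nat.GCD using (gcd; gcd-greatest; gcd-identityˡ; gcd[m,n]∣m; gcd[m,n]∣n; gcd-comm; gcd[m,n]≢0)
open import Data.Nat.Primality using (prime?; euclidsLemma)
open import Data.Nat.Tactic.RingSolver using (solve-∀)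
open import Data.Fin using (Fin)
import Data.Fin as Fin
open import Data.List using (List; []; _∷_; _++_; length; take; drop; filter; map; allFin; cartesianProductWith)
open import Data.List.Properties
  using (≡-dec; length-++; length-++-comm; length-map; length-tabulate; ++-assoc; ++-identityʳ; take++drop≡id; length-take; length-drop; take-take)
open import Data.List.Membership.Propositional using (_∈_)
open import Data.List.Membership.Propositional.Properties
  using (∈-filter⁺; ∈-filter⁻; ∈-map⁺; ∈-map⁻; ∈-cartesianProductWith⁺; ∈-cartesianProductWith⁻; ∈-allFin)
open import Data.List.Membership.Propositional.Properties.WithK using (unique∧set⇒bag)
import Data.List.Membership.DecPropositional as DecMembership
open import Data.List.Relation.Unary.Any using (here)
import Data.List.Relation.Unary.All as All
import Data.List.Relation.Unary.AllPairs as AllPairs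
open import Data.List.Relation.Unary.Unique.Propositional using (Unique)
import Data.List.Relation.Unary.Unique.Propositional.Properties as Unique
open import Data.List.Relation.Binary.BagAndSetEquality using (∼bag⇒↭)
open import Data.List.Relation.Binary.Permutation.Propositional.Properties using (↭-length)
open import Data.Maybe using (Maybe; just; nothing)
import Data.Maybe.Properties as Maybe
open import Data.Product using (_×_; _,_; proj₁; proj₂; ∃-syntax; map₂)
open import Data.Sum using (_⊎_; inj₁; inj₂; [_,_]′)
import Data.Sum as Sum
open import Data.Empty using (⊥-elim)
open import Function.Base using (id)
open import Function.Bundles using (_⇔_; mk⇔; Equivalence)
open import Function.Construct.Composition using (_⇔-∘_)
open import Relation.Nullary using (¬_; Dec; yes; no)
open import Relation.Nullary.Decidable using (_×-dec_; from-yes; from-no)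
open import Relation.Unary using (Decidable)
open import Relation.Unary.Properties using (∁?)
open import Relation.Binary using (DecidableEquality)
open import Relation.Binary.PropositionalEquality

-- Arithmetic

gcd>0 : ∀ m n → 0 < m → 0 < gcd m n
gcd>0 m n m>0 = n≢0⇒n>0 (gcd[m,n]≢0 m n (inj₁ (λ m≡0 → <⇒≢ m>0 (sym m≡0))))

gcd[n,n]≡n : ∀ n → gcd n n ≡ n
gcd[n,n]≡n n = ∣-antisym (gcd[m,n]∣m n n) (gcd-greatest ∣-refl ∣-refl)

gcd[m∸n,n]≡gcd[m,n] : ∀ {m n} → n ≤ m → gcd (m ∸ n) n ≡ gcd m n
gcd[m∸n,n]≡gcd[m,n] {m} {n} n≤m = ∣-antisym
  (gcd-greatest (∣m∸n∣n⇒∣m _ n≤m (gcd[m,n]∣m (m ∸ n) n) (gcd[m,n]∣n (m ∸ n) n)) (gcd[m,n]∣n (m ∸ n) n))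
  (gcd-greatest (∣m+n∣m⇒∣n (subst (gcd m n ∣_) (sym (m+[n∸m]≡n n≤m)) (gcd[m,n]∣m m n)) (gcd[m,n]∣n m n))
                (gcd[m,n]∣n m n))

∣⇒≤′ : ∀ {m n} → 0 < n → m ∣ n → m ≤ n
∣⇒≤′ n>0 = ∣⇒≤ {{>-nonZero n>0}}

m<n∸o⇒o+m<n : ∀ m n o → m < n ∸ o → o + m < n
m<n∸o⇒o+m<n m n       zero    lt = lt
m<n∸o⇒o+m<n m (suc n) (suc o) lt = s≤s (m<n∸o⇒o+m<n m n o lt)

<-trichotomy : ∀ m n → m < n ⊎ m ≡ n ⊎ n < m
<-trichotomy zero    zero    = inj₂ (inj₁ refl)
<-trichotomy zero    (suc n) = inj₁ (s≤s z≤n)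
<-trichotomy (suc m) zero    = inj₂ (inj₂ (s≤s z≤n))
<-trichotomy (suc m) (suc n) with <-trichotomy m n
... | inj₁ m<n        = inj₁ (s≤s m<n)
... | inj₂ (inj₁ m≡n) = inj₂ (inj₁ (cong suc m≡n))
... | inj₂ (inj₂ n<m) = inj₂ (inj₂ (s≤s n<m))

∀<? : {P : ℕ → Set} → (∀ i → Dec (P i)) → ∀ n → Dec (∀ i → i < n → P i)
∀<? P? zero = yes (λ _ ())
∀<? {P} P? (suc n) with ∀<? P? n | P? n
... | no ¬below | _      = no (λ all → ¬below (λ i i<n → all i (m<n⇒m<1+n i<n)))
... | yes below | no ¬Pn = no (λ all → ¬Pn (all n ≤-refl))
... | yes below | yes Pn = yes (λ i i<1+n → [ below i , (λ i≡n → subst P (sym i≡n) Pn) ]′ (m<1+n⇒m<n∨m≡n i<1+n))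

least-witness : {P : ℕ → Set} → (∀ n → Dec (P n)) → ∀ {n} → P n →
                ∃[ d ] P d × (∀ e → e < d → ¬ P e)
least-witness P? {zero} P0 = 0 , P0 , λ _ ()
least-witness P? {suc n} Psn with P? 0 | least-witness (λ i → P? (suc i)) Psn
... | yes P0 | _               = 0 , P0 , λ _ ()
... | no ¬P0 | d , Pd , below = suc d , Pd , λ { zero _ → ¬P0 ; (suc e) (s≤s e<d) → below e e<d }

∣⇒≡∨2*≤ : ∀ {d L} → 0 < L → d ∣ L → d ≡ L ⊎ 2 * d ≤ L
∣⇒≡∨2*≤ {d} L>0 (divides zero refl)          = ⊥-elim (<⇒≢ L>0 refl)
∣⇒≡∨2*≤ {d} L>0 (divides (suc zero) refl)    = inj₁ (sym (+-identityʳ d))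
∣⇒≡∨2*≤ {d} L>0 (divides (suc (suc c)) refl) = inj₂ (*-monoˡ-≤ d {2} {2 + c} (s≤s (s≤s z≤n)))

+-≤-halves : ∀ {d e L} → 2 * d ≤ L → 2 * e ≤ L → d + e ≤ L
+-≤-halves {d} {e} {L} 2d≤L 2e≤L = *-cancelˡ-≤ 2 (begin
    2 * (d + e)   ≡⟨ *-distribˡ-+ 2 d e ⟩
    2 * d + 2 * e ≤⟨ +-mono-≤ 2d≤L 2e≤L ⟩
    L + L         ≡⟨ cong (L +_) (sym (+-identityʳ L)) ⟩
    2 * L         ∎)
  where open ≤-Reasoning

divisors-bound : ∀ {d e L} → 0 < L → d ∣ L → e ∣ L → d + e ≤ L + gcd d e
divisors-bound {d} {e} {L} L>0 d∣L e∣L with ∣⇒≡∨2*≤ L>0 d∣L | ∣⇒≡∨2*≤ L>0 e∣L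
... | inj₁ refl | _         = ≤-reflexive (cong (d +_) (sym (∣-antisym (gcd[m,n]∣n d e) (gcd-greatest e∣L ∣-refl))))
... | inj₂ _    | inj₁ refl = ≤-reflexive (trans (+-comm d e) (cong (e +_) (sym (∣-antisym (gcd[m,n]∣m d e) (gcd-greatest ∣-refl d∣L)))))
... | inj₂ 2d≤L | inj₂ 2e≤L = ≤-trans (+-≤-halves {d} {e} 2d≤L 2e≤L) (m≤m+n L (gcd d e))

-- The Fine–Wilf hypothesis for a period d of a word of length L and the length e of any proper root of it.
FineWilfBound : ℕ → ℕ → Set
FineWilfBound d L = ∀ {e m} → 2 ≤ m → m * e ≡ L → d + e ≤ L + gcd d e

FineWilfBound-half : ∀ {d L} → 2 * d ≤ L → FineWilfBound d L
FineWilfBound-half {d} {L} 2d≤L {e} 2≤m me≡L =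
  ≤-trans (+-≤-halves {d} {e} 2d≤L (subst (2 * e ≤_) me≡L (*-monoˡ-≤ e 2≤m))) (m≤m+n L (gcd d e))

FineWilfBound-by-common-divisor : ∀ {t d e L} → t ∣ d → t ∣ e → d + e ≤ L + t → d + e ≤ L + gcd d e
FineWilfBound-by-common-divisor {d = zero}  {e} {L} _   _   _ = subst (e ≤_) (cong (L +_) (sym (gcd-identityˡ e))) (m≤n+m e L)
FineWilfBound-by-common-divisor {t} {suc d} {e} {L} t∣d t∣e d+e≤L+t =
  ≤-trans d+e≤L+t (+-monoʳ-≤ L (∣⇒≤′ (gcd>0 (suc d) e (s≤s z≤n)) (gcd-greatest t∣d t∣e)))

3∣4*a⇒3∣a : ∀ a → 3 ∣ 4 * a → 3 ∣ a
3∣4*a⇒3∣a a 3∣4a = [ (λ 3∣4 → ⊥-elim (from-no (3 ∣? 4) 3∣4)) , id ]′ (euclidsLemma 4 a (from-yes (prime? 3)) 3∣4a)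

2∣5*a⇒2∣a : ∀ a → 2 ∣ 5 * a → 2 ∣ a
2∣5*a⇒2∣a a 2∣5a = [ (λ 2∣5 → ⊥-elim (from-no (2 ∣? 5) 2∣5)) , id ]′ (euclidsLemma 5 a (from-yes (prime? 2)) 2∣5a)

FineWilfBound[3a,4a] : ∀ a → FineWilfBound (3 * a) (4 * a)
FineWilfBound[3a,4a] a {m = 1} (s≤s ()) _
FineWilfBound[3a,4a] a {e} {2} _ 2e≡4a = FineWilfBound-by-common-divisor {a} {L = 4 * a} (n∣m*n 3) (divides 2 e≡2a)
    (subst (λ x → 3 * a + x ≤ 4 * a + a) (sym e≡2a) (≤-reflexive (sum a)))
  where
    e≡2a : e ≡ 2 * a
    e≡2a = *-cancelˡ-≡ e (2 * a) 2 (trans 2e≡4a (*-assoc 2 2 a))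
    sum : ∀ a → 3 * a + 2 * a ≡ 4 * a + a
    sum = solve-∀
FineWilfBound[3a,4a] a {e} {3} _ 3e≡4a with 3∣4*a⇒3∣a a (divides e (trans (sym 3e≡4a) (*-comm 3 e)))
... | divides t refl = FineWilfBound-by-common-divisor {t} {L = 4 * (t * 3)} (∣n⇒∣m*n 3 (m∣m*n 3)) (divides 4 e≡4t)
    (subst (λ x → 3 * (t * 3) + x ≤ 4 * (t * 3) + t) (sym e≡4t) (≤-reflexive (sum t)))
  where
    regroup : ∀ t → 4 * (t * 3) ≡ 3 * (4 * t)
    regroup = solve-∀
    e≡4t : e ≡ 4 * t
    e≡4t = *-cancelˡ-≡ e (4 * t) 3 (trans 3e≡4a (regroup t))
    sum : ∀ t → 3 * (t * 3) + 4 * t ≡ 4 * (t * 3) + t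
    sum = solve-∀
FineWilfBound[3a,4a] a {e} {suc (suc (suc (suc m)))} _ me≡4a =
  ≤-trans (+-monoʳ-≤ (3 * a) e≤a) (≤-trans (≤-reflexive (sum a)) (m≤m+n (4 * a) _))
  where
    e≤a : e ≤ a
    e≤a = *-cancelˡ-≤ 4 (subst (4 * e ≤_) me≡4a (*-monoˡ-≤ e {4} {4 + m} (s≤s (s≤s (s≤s (s≤s z≤n))))))
    sum : ∀ a → 3 * a + a ≡ 4 * a
    sum = solve-∀

FineWilfBound[3a,5a] : ∀ a → FineWilfBound (3 * a) (5 * a)
FineWilfBound[3a,5a] a {m = 1} (s≤s ()) _
FineWilfBound[3a,5a] a {e} {2} _ 2e≡5a with 2∣5*a⇒2∣a a (divides e (trans (sym 2e≡5a) (*-comm 2 e)))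
... | divides t refl = FineWilfBound-by-common-divisor {t} {L = 5 * (t * 2)} (∣n⇒∣m*n 3 (m∣m*n 2)) (divides 5 e≡5t)
    (subst (λ x → 3 * (t * 2) + x ≤ 5 * (t * 2) + t) (sym e≡5t) (≤-reflexive (sum t)))
  where
    regroup : ∀ t → 5 * (t * 2) ≡ 2 * (5 * t)
    regroup = solve-∀
    e≡5t : e ≡ 5 * t
    e≡5t = *-cancelˡ-≡ e (5 * t) 2 (trans 2e≡5a (regroup t))
    sum : ∀ t → 3 * (t * 2) + 5 * t ≡ 5 * (t * 2) + t
    sum = solve-∀
FineWilfBound[3a,5a] a {e} {suc (suc (suc m))} _ me≡5a =
  ≤-trans (+-monoʳ-≤ (3 * a) e≤2a) (≤-trans (≤-reflexive (sum a)) (m≤m+n (5 * a) _))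
  where
    3e≤6a : 3 * e ≤ 3 * (2 * a)
    3e≤6a = ≤-trans (subst (3 * e ≤_) me≡5a (*-monoˡ-≤ e {3} {3 + m} (s≤s (s≤s (s≤s z≤n)))))
                    (≤-trans (*-monoˡ-≤ a {5} {6} (s≤s (s≤s (s≤s (s≤s (s≤s z≤n)))))) (≤-reflexive (*-assoc 3 2 a)))
    e≤2a : e ≤ 2 * a
    e≤2a = *-cancelˡ-≤ 3 3e≤6a
    sum : ∀ a → 3 * a + 2 * a ≡ 5 * a
    sum = solve-∀

FineWilfBound[3a,[3s+1]a] : ∀ a {s} → 1 ≤ s → FineWilfBound (3 * a) ((3 * s + 1) * a)
FineWilfBound[3a,[3s+1]a] a {1}           _ = FineWilfBound[3a,4a] a
FineWilfBound[3a,[3s+1]a] a {suc (suc s)} _ = FineWilfBound-half (subst (2 * (3 * a) ≤_) (sym (split s a)) (m≤m+n _ _))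
  where
    split : ∀ s a → (3 * (2 + s) + 1) * a ≡ 2 * (3 * a) + (3 * s + 1) * a
    split = solve-∀

FineWilfBound[3a,[3s+2]a] : ∀ a {s} → 1 ≤ s → FineWilfBound (3 * a) ((3 * s + 2) * a)
FineWilfBound[3a,[3s+2]a] a {1}           _ = FineWilfBound[3a,5a] a
FineWilfBound[3a,[3s+2]a] a {suc (suc s)} _ = FineWilfBound-half (subst (2 * (3 * a) ≤_) (sym (split s a)) (m≤m+n _ _))
  where
    split : ∀ s a → (3 * (2 + s) + 2) * a ≡ 2 * (3 * a) + (3 * s + 2) * a
    split = solve-∀

¬d∣c*d+r : ∀ {c d r} → 0 < r → r < d → ¬ d ∣ c * d + r
¬d∣c*d+r {c} r>0 r<d d∣ = <⇒≱ r<d (∣⇒≤′ r>0 (∣m+n∣m⇒∣n d∣ (n∣m*n c)))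

exponent≡3s+1⊎3s+2 : ∀ {K} → 2 ≤ K → ¬ 3 ∣ K → K ≢ 2 → ∃[ s ] 1 ≤ s × (K ≡ 3 * s + 1 ⊎ K ≡ 3 * s + 2)
exponent≡3s+1⊎3s+2 {K} 2≤K ¬3∣K K≢2 with K / 3 | K % 3 | m≡m%n+[m/n]*n K 3 | m%n<n K 3
... | s       | 0 | K≡ | _ = ⊥-elim (¬3∣K (divides s K≡))
... | 0       | 1 | K≡ | _ = ⊥-elim (<⇒≱ (subst (_< 2) (sym K≡) ≤-refl) 2≤K)
... | 0       | 2 | K≡ | _ = ⊥-elim (K≢2 K≡)
... | suc s   | 1 | K≡ | _ = suc s , s≤s z≤n , inj₁ (trans K≡ (trans (+-comm 1 (suc s * 3)) (cong (_+ 1) (*-comm (suc s) 3))))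
... | suc s   | 2 | K≡ | _ = suc s , s≤s z≤n , inj₂ (trans K≡ (trans (+-comm 2 (suc s * 3)) (cong (_+ 2) (*-comm (suc s) 3))))
... | _       | suc (suc (suc _)) | _ | s≤s (s≤s (s≤s ()))

¬3∣3s+r : ∀ s {r} → 0 < r → r < 3 → ¬ 3 ∣ 3 * s + r
¬3∣3s+r s {r} r>0 r<3 = subst (λ n → ¬ 3 ∣ n) (cong (_+ r) (*-comm s 3)) (¬d∣c*d+r {s} r>0 r<3)

3∣cofactor : ∀ {K d l} → ¬ 3 ∣ K → K * d ≡ 3 * l → 3 ∣ d
3∣cofactor {K} {d} {l} ¬3∣K Kd≡3l =
  [ (λ 3∣K → ⊥-elim (¬3∣K 3∣K)) , id ]′ (euclidsLemma K d (from-yes (prime? 3)) (divides l (trans Kd≡3l (*-comm 3 l))))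

odd-* : ∀ m n → m % 2 ≡ 1 → n % 2 ≡ 1 → (m * n) % 2 ≡ 1
odd-* m n m-odd n-odd = trans (%-distribˡ-* m n 2) (cong₂ (λ x y → (x * y) % 2) m-odd n-odd)

odd-^ : ∀ m e → m % 2 ≡ 1 → (m ^ e) % 2 ≡ 1
odd-^ m zero    _     = refl
odd-^ m (suc e) m-odd = odd-* m (m ^ e) m-odd (odd-^ m e m-odd)

odd⇒≢2* : ∀ n → n % 2 ≡ 1 → ∀ h → 2 * h ≢ n
odd⇒≢2* n n-odd h 2h≡n = 0≢1+n (trans (sym (trans (cong (_% 2) (*-comm 2 h)) (m*n%n≡0 h 2))) (trans (cong (_% 2) 2h≡n) n-odd))

-- Periods and the Fine–Wilf theorem

module _ {A : Set} where

  at : List A → ℕ → Maybe A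
  at []       _       = nothing
  at (x ∷ xs) zero    = just x
  at (x ∷ xs) (suc i) = at xs i

  at-++ˡ : ∀ (xs ys : List A) {i} → i < length xs → at (xs ++ ys) i ≡ at xs i
  at-++ˡ (x ∷ xs) ys {zero}  _       = refl
  at-++ˡ (x ∷ xs) ys {suc i} (s≤s p) = at-++ˡ xs ys p

  at-++ʳ : ∀ (xs ys : List A) i → at (xs ++ ys) (length xs + i) ≡ at ys i
  at-++ʳ []       ys i = refl
  at-++ʳ (x ∷ xs) ys i = at-++ʳ xs ys i

  at-take : ∀ k (xs : List A) {i} → i < k → at (take k xs) i ≡ at xs i
  at-take (suc k) []       _       = refl
  at-take (suc k) (x ∷ xs) {zero}  _       = refl
  at-take (suc k) (x ∷ xs) {suc i} (s≤s p) = at-take k xs p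

  at-drop : ∀ k (xs : List A) i → at (drop k xs) i ≡ at xs (k + i)
  at-drop zero    xs       i = refl
  at-drop (suc k) []       i = refl
  at-drop (suc k) (x ∷ xs) i = at-drop k xs i

  at-ext : ∀ (xs ys : List A) → length xs ≡ length ys → (∀ i → i < length xs → at xs i ≡ at ys i) → xs ≡ ys
  at-ext []       []       _   _    = refl
  at-ext (x ∷ xs) (y ∷ ys) len same with same 0 (s≤s z≤n)
  ... | refl = cong (x ∷_) (at-ext xs ys (suc-injective len) (λ i i<n → same (suc i) (s≤s i<n)))

  length-take-≤ : ∀ k (xs : List A) → k ≤ length xs → length (take k xs) ≡ k
  length-take-≤ k xs k≤ = trans (length-take k xs) (m≤n⇒m⊓n≡m k≤)

  take-length-++ : ∀ (xs ys : List A) → take (length xs) (xs ++ ys) ≡ xs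
  take-length-++ []       ys = refl
  take-length-++ (x ∷ xs) ys = cong (x ∷_) (take-length-++ xs ys)

  drop-length-++ : ∀ (xs ys : List A) → drop (length xs) (xs ++ ys) ≡ ys
  drop-length-++ []       ys = refl
  drop-length-++ (x ∷ xs) ys = drop-length-++ xs ys

  take-drop-++ : ∀ {n} (xs ys : List A) → length xs ≡ n → (take n (xs ++ ys) , drop n (xs ++ ys)) ≡ (xs , ys)
  take-drop-++ xs ys refl = cong₂ _,_ (take-length-++ xs ys) (drop-length-++ xs ys)

  length≡0⇒[] : ∀ (xs : List A) → length xs ≡ 0 → xs ≡ []
  length≡0⇒[] [] _ = refl

  ≢[]⇒length>0 : ∀ (xs : List A) → xs ≢ [] → 0 < length xs
  ≢[]⇒length>0 []      xs≢[] = ⊥-elim (xs≢[] refl)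
  ≢[]⇒length>0 (_ ∷ _) _     = s≤s z≤n

  length>0⇒≢[] : ∀ (xs : List A) → 0 < length xs → xs ≢ []
  length>0⇒≢[] (_ ∷ _) _ ()

  HasPeriod : ℕ → List A → Set
  HasPeriod d x = ∀ i → i + d < length x → at x i ≡ at x (i + d)

  HasPeriod? : DecidableEquality A → ∀ d x → Dec (HasPeriod d x)
  HasPeriod? _≟_ d x with ∀<? (λ i → Maybe.≡-dec _≟_ (at x i) (at x (i + d))) (length x ∸ d)
  ... | yes below = yes λ i lt → below i (m+n≤o⇒m≤o∸n (suc i) lt)
  ... | no ¬below = no λ P → ¬below λ i lt →
                      P i (subst (_< length x) (+-comm d i) (m<n∸o⇒o+m<n i (length x) d lt))

  HasPeriod-take : ∀ {d} k x → HasPeriod d x → HasPeriod d (take k x)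
  HasPeriod-take {d} k x P i lt =
    trans (at-take k x (<-≤-trans (m<m+n+1 i d) i+d<k)) (trans (P i i+d<x) (sym (at-take k x i+d<k)))
    where
      i+d<k : i + d < k
      i+d<k = m<n⊓o⇒m<n k (length x) (subst (i + d <_) (length-take k x) lt)
      i+d<x : i + d < length x
      i+d<x = m<n⊓o⇒m<o k (length x) (subst (i + d <_) (length-take k x) lt)
      m<m+n+1 : ∀ m n → m < suc (m + n)
      m<m+n+1 m n = s≤s (m≤m+n m n)

  HasPeriod-drop : ∀ {d} k x → HasPeriod d x → HasPeriod d (drop k x)
  HasPeriod-drop {d} k x P i lt = begin
      at (drop k x) i      ≡⟨ at-drop k x i ⟩
      at x (k + i)         ≡⟨ P (k + i) k+i+d<x ⟩
      at x (k + i + d)     ≡⟨ cong (at x) (+-assoc k i d) ⟩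
      at x (k + (i + d))   ≡⟨ sym (at-drop k x (i + d)) ⟩
      at (drop k x) (i + d) ∎
    where
      open ≡-Reasoning
      k+i+d<x : k + i + d < length x
      k+i+d<x = subst (_< length x) (sym (+-assoc k i d))
                  (m<n∸o⇒o+m<n (i + d) (length x) k (subst (i + d <_) (length-drop k x) lt))

  HasPeriod-* : ∀ {d} c x → HasPeriod d x → HasPeriod (c * d) x
  HasPeriod-* zero    x P i _  = cong (at x) (sym (+-identityʳ i))
  HasPeriod-* {d} (suc c) x P i lt =
    trans (P i (≤-<-trans (m≤m+n (i + d) (c * d)) lt′))
          (trans (HasPeriod-* c x P (i + d) lt′) (cong (at x) (+-assoc i d (c * d))))
    where
      lt′ : i + d + c * d < length x
      lt′ = subst (_< length x) (sym (+-assoc i d (c * d))) lt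

  -- Reduce i modulo q; a shift by g leaving the prefix of length q = c * g is, modulo q, a shift
  -- by (c - 1) * g inside that prefix.
  HasPeriod-lift : ∀ {g q} x → 0 < q → g ∣ q → q ≤ length x → HasPeriod q x → HasPeriod g (take q x) → HasPeriod g x
  HasPeriod-lift {g} {q} x q>0 g∣q q≤x Pq Pg i i+g<x = begin
      at x i               ≡⟨ cong (at x) i≡r+tq ⟩
      at x (r + t * q)     ≡⟨ sym (HasPeriod-* t x Pq r (subst (_< length x) i≡r+tq (≤-<-trans (m≤m+n i g) i+g<x))) ⟩
      at x r               ≡⟨ shift-in-prefix ⟩
      at x (r + g)         ≡⟨ HasPeriod-* t x Pq (r + g) (subst (_< length x) i+g≡r+g+tq i+g<x) ⟩
      at x (r + g + t * q) ≡⟨ cong (at x) (sym i+g≡r+g+tq) ⟩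
      at x (i + g)         ∎
    where
      open ≡-Reasoning
      instance q≢0 : NonZero q
      q≢0 = >-nonZero q>0
      r = i % q
      t = i / q
      i≡r+tq : i ≡ r + t * q
      i≡r+tq = m≡m%n+[m/n]*n i q
      i+g≡r+g+tq : i + g ≡ r + g + t * q
      i+g≡r+g+tq = trans (cong (_+ g) i≡r+tq)
                     (trans (+-assoc r (t * q) g) (trans (cong (r +_) (+-comm (t * q) g)) (sym (+-assoc r g (t * q)))))
      in-prefix : ∀ {d} → HasPeriod d (take q x) → ∀ j → j + d < q → at x j ≡ at x (j + d)
      in-prefix {d} P j j+d<q =
        trans (sym (at-take q x (≤-<-trans (m≤m+n j d) j+d<q)))
              (trans (P j (subst (j + d <_) (sym (length-take-≤ q x q≤x)) j+d<q)) (at-take q x j+d<q))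
      shift-in-prefix : at x r ≡ at x (r + g)
      shift-in-prefix with r + g <? q
      ... | yes r+g<q = in-prefix Pg r r+g<q
      ... | no r+g≮q = begin
          at x r             ≡⟨ cong (at x) r≡u+c′g ⟩
          at x (u + c′ * g)  ≡⟨ sym (in-prefix (HasPeriod-* c′ (take q x) Pg) u (subst (_< q) r≡u+c′g (m%n<n i q))) ⟩
          at x u             ≡⟨ Pq u (subst (_< length x) r+g≡u+q (≤-<-trans (m≤m+n (r + g) (t * q)) (subst (_< length x) i+g≡r+g+tq i+g<x))) ⟩
          at x (u + q)       ≡⟨ cong (at x) (sym r+g≡u+q) ⟩
          at x (r + g)       ∎
        where
          u = r + g ∸ q
          c′ = quotient g∣q ∸ 1
          r+g≡u+q : r + g ≡ u + q
          r+g≡u+q = sym (m∸n+n≡m (≮⇒≥ r+g≮q))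
          q∸g≡c′g : q ∸ g ≡ c′ * g
          q∸g≡c′g = trans (cong (_∸ g) (_∣_.equality g∣q))
                      (trans (cong (quotient g∣q * g ∸_) (sym (*-identityˡ g))) (sym (*-distribʳ-∸ g (quotient g∣q) 1)))
          r≡u+c′g : r ≡ u + c′ * g
          r≡u+c′g = +-cancelʳ-≡ g r (u + c′ * g)
                      (trans r+g≡u+q (trans (cong (u +_) (trans (sym (m∸n+n≡m (∣⇒≤′ q>0 g∣q))) (cong (_+ g) q∸g≡c′g)))
                                             (sym (+-assoc u (c′ * g) g))))

  HasPeriod-∸ : ∀ {p q} x → q ≤ p → HasPeriod p x → HasPeriod q x → HasPeriod (p ∸ q) (take (length x ∸ q) x)
  HasPeriod-∸ {p} {q} x q≤p Pp Pq i lt = begin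
      at x′ i      ≡⟨ at-take L x (≤-<-trans (m≤m+n i (p ∸ q)) j<L) ⟩
      at x i       ≡⟨ Pp i (subst (_< length x) (sym i+p≡j+q) j+q<x) ⟩
      at x (i + p) ≡⟨ cong (at x) i+p≡j+q ⟩
      at x (j + q) ≡⟨ sym (Pq j j+q<x) ⟩
      at x j       ≡⟨ sym (at-take L x j<L) ⟩
      at x′ j      ∎
    where
      open ≡-Reasoning
      L = length x ∸ q
      x′ = take L x
      j = i + (p ∸ q)
      j<L : j < L
      j<L = m<n⊓o⇒m<n L (length x) (subst (j <_) (length-take L x) lt)
      j+q<x : j + q < length x
      j+q<x = subst (_< length x) (+-comm q j) (m<n∸o⇒o+m<n j (length x) q j<L)
      i+p≡j+q : i + p ≡ j + q
      i+p≡j+q = trans (cong (i +_) (sym (m∸n+n≡m q≤p))) (sym (+-assoc i (p ∸ q) q))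

  fine-wilf-fuel : ∀ f {p q} x → p + q ≤ f → 0 < p → 0 < q → HasPeriod p x → HasPeriod q x →
                   p + q ≤ length x + gcd p q → HasPeriod (gcd p q) x
  fine-wilf-step : ∀ f {p q} x → p + q ≤ f → q < p → 0 < q → HasPeriod p x → HasPeriod q x →
                   p + q ≤ length x + gcd p q → HasPeriod (gcd p q) x

  fine-wilf-fuel f {p} {q} x p+q≤f p>0 q>0 Pp Pq bound with <-trichotomy p q
  ... | inj₂ (inj₁ refl) = subst (λ g → HasPeriod g x) (sym (gcd[n,n]≡n p)) Pp
  ... | inj₂ (inj₂ q<p) = fine-wilf-step f x p+q≤f q<p q>0 Pp Pq bound
  ... | inj₁ p<q = subst (λ g → HasPeriod g x) (gcd-comm q p)
                         (fine-wilf-step f x (subst (_≤ f) (+-comm p q) p+q≤f) p<q p>0 Pq Pp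
                           (subst₂ (λ a b → a ≤ length x + b) (+-comm p q) (gcd-comm p q) bound))

  -- Euclid's algorithm: the prefix of length |x| ∸ q has the periods p ∸ q and q, whose gcd is gcd p q,
  -- and a period g of it lifts back to x.
  fine-wilf-step zero    x p+q≤0 q<p q>0 _ _ _ = ⊥-elim (<⇒≱ (<-≤-trans q>0 (m≤n+m _ _)) p+q≤0)
  fine-wilf-step (suc f) {p} {q} x p+q≤f q<p q>0 Pp Pq bound =
    HasPeriod-lift x q>0 (gcd[m,n]∣n p q) q≤x Pq (subst (HasPeriod g) prefix (HasPeriod-take q x′ Pg′))
    where
      g = gcd p q
      q≤p = <⇒≤ q<p
      L = length x ∸ q
      x′ = take L x
      g≤p∸q : g ≤ p ∸ q
      g≤p∸q = ∣⇒≤′ (m<n⇒0<n∸m q<p)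
                (∣m+n∣m⇒∣n (subst (g ∣_) (sym (m+[n∸m]≡n q≤p)) (gcd[m,n]∣m p q)) (gcd[m,n]∣n p q))
      q+q≤x : q + q ≤ length x
      q+q≤x = +-cancelʳ-≤ g (q + q) (length x) (begin
          q + q + g   ≡⟨ trans (+-assoc q q g) (+-comm q (q + g)) ⟩
          q + g + q   ≤⟨ +-monoˡ-≤ q (subst (q + g ≤_) (m+[n∸m]≡n q≤p) (+-monoʳ-≤ q g≤p∸q)) ⟩
          p + q       ≤⟨ bound ⟩
          length x + g ∎)
        where open ≤-Reasoning
      q≤x : q ≤ length x
      q≤x = ≤-trans (m≤m+n q q) q+q≤x
      q≤L : q ≤ L
      q≤L = m+n≤o⇒m≤o∸n q q+q≤x
      bound′ : p ∸ q + q ≤ length x′ + gcd (p ∸ q) q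
      bound′ = subst₂ _≤_ (sym (m∸n+n≡m q≤p))
                 (cong₂ _+_ (sym (length-take-≤ L x (m∸n≤m (length x) q))) (sym (gcd[m∸n,n]≡gcd[m,n] q≤p)))
                 (subst (p ≤_) (+-∸-comm g q≤x) (m+n≤o⇒m≤o∸n p bound))
      p≤f : p ∸ q + q ≤ f
      p≤f = subst (_≤ f) (sym (m∸n+n≡m q≤p)) (≤-pred (≤-trans (subst (_≤ p + q) (+-comm p 1) (+-monoʳ-≤ p q>0)) p+q≤f))
      Pg′ : HasPeriod g x′
      Pg′ = subst (λ d → HasPeriod d x′) (gcd[m∸n,n]≡gcd[m,n] q≤p)
              (fine-wilf-fuel f x′ p≤f (m<n⇒0<n∸m q<p) q>0 (HasPeriod-∸ x q≤p Pp Pq) (HasPeriod-take L x Pq) bound′)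
      prefix : take q x′ ≡ take q x
      prefix = trans (take-take q L x) (cong (λ n → take n x) (m≤n⇒m⊓n≡m q≤L))

  fine-wilf : ∀ {p q} x → 0 < p → 0 < q → HasPeriod p x → HasPeriod q x →
              p + q ≤ length x + gcd p q → HasPeriod (gcd p q) x
  fine-wilf {p} {q} x = fine-wilf-fuel (p + q) x ≤-refl

  HasPeriod-ext : ∀ {d} (x y : List A) → 0 < d → length x ≡ length y → HasPeriod d x → HasPeriod d y →
                  take d x ≡ take d y → x ≡ y
  HasPeriod-ext {d} x y d>0 |x|≡|y| Px Py prefix = at-ext x y |x|≡|y| λ i i<x → begin
      at x i                ≡⟨ reduce x Px i<x ⟩
      at x (i % d)          ≡⟨ sym (at-take d x (m%n<n i d)) ⟩
      at (take d x) (i % d) ≡⟨ cong (λ u → at u (i % d)) prefix ⟩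
      at (take d y) (i % d) ≡⟨ at-take d y (m%n<n i d) ⟩
      at y (i % d)          ≡⟨ sym (reduce y Py (subst (i <_) |x|≡|y| i<x)) ⟩
      at y i                ∎
    where
      open ≡-Reasoning
      instance d≢0 : NonZero d
      d≢0 = >-nonZero d>0
      reduce : ∀ u → HasPeriod d u → ∀ {i} → i < length u → at u i ≡ at u (i % d)
      reduce u P {i} i<u = sym (trans (HasPeriod-* (i / d) u P (i % d) (subst (_< length u) i≡ i<u)) (cong (at u) (sym i≡)))
        where
          i≡ : i ≡ i % d + i / d * d
          i≡ = m≡m%n+[m/n]*n i d

-- Powers and primitive words

module _ {k : ℕ} where

  ^ʷ-+ : ∀ (v : Word k) m n → v ^ʷ (m + n) ≡ v ^ʷ m ++ v ^ʷ n
  ^ʷ-+ v zero    n = refl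
  ^ʷ-+ v (suc m) n = trans (cong (v ++_) (^ʷ-+ v m n)) (sym (++-assoc v (v ^ʷ m) (v ^ʷ n)))

  ^ʷ-suc : ∀ (v : Word k) m → v ^ʷ suc m ≡ v ^ʷ m ++ v
  ^ʷ-suc v m = begin
      v ^ʷ suc m         ≡⟨ cong (v ^ʷ_) (+-comm 1 m) ⟩
      v ^ʷ (m + 1)       ≡⟨ ^ʷ-+ v m 1 ⟩
      v ^ʷ m ++ (v ++ []) ≡⟨ cong (v ^ʷ m ++_) (++-identityʳ v) ⟩
      v ^ʷ m ++ v        ∎
    where open ≡-Reasoning

  ^ʷ-* : ∀ (v : Word k) m n → v ^ʷ (m * n) ≡ (v ^ʷ n) ^ʷ m
  ^ʷ-* v zero    n = refl
  ^ʷ-* v (suc m) n = trans (^ʷ-+ v n (m * n)) (cong (v ^ʷ n ++_) (^ʷ-* v m n))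

  length-^ʷ : ∀ (v : Word k) m → length (v ^ʷ m) ≡ m * length v
  length-^ʷ v zero    = refl
  length-^ʷ v (suc m) = trans (length-++ v) (cong (length v +_) (length-^ʷ v m))

  ^ʷ-injective : ∀ {u v : Word k} c → u ^ʷ suc c ≡ v ^ʷ suc c → u ≡ v
  ^ʷ-injective {u} {v} c eq = begin
      u                               ≡⟨ sym (take-length-++ u (u ^ʷ c)) ⟩
      take (length u) (u ^ʷ suc c)    ≡⟨ cong₂ take |u|≡|v| eq ⟩
      take (length v) (v ^ʷ suc c)    ≡⟨ take-length-++ v (v ^ʷ c) ⟩
      v                               ∎
    where
      open ≡-Reasoning
      |u|≡|v| : length u ≡ length v
      |u|≡|v| = *-cancelˡ-≡ (length u) (length v) (suc c)
                  (trans (sym (length-^ʷ u (suc c))) (trans (cong length eq) (length-^ʷ v (suc c))))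

  HasPeriod-^ʷ : ∀ (v : Word k) m → HasPeriod (length v) (v ^ʷ m)
  HasPeriod-^ʷ v zero    i ()
  HasPeriod-^ʷ v (suc m) i lt = begin
      at (v ^ʷ suc m) i                  ≡⟨ cong (λ w → at w i) (^ʷ-suc v m) ⟩
      at (v ^ʷ m ++ v) i                 ≡⟨ at-++ˡ (v ^ʷ m) v i<vᵐ ⟩
      at (v ^ʷ m) i                      ≡⟨ sym (at-++ʳ v (v ^ʷ m) i) ⟩
      at (v ^ʷ suc m) (length v + i)     ≡⟨ cong (at (v ^ʷ suc m)) (+-comm (length v) i) ⟩
      at (v ^ʷ suc m) (i + length v)     ∎
    where
      open ≡-Reasoning
      i<vᵐ : i < length (v ^ʷ m)
      i<vᵐ = +-cancelʳ-< _ _ _ (subst (i + length v <_)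
               (trans (length-^ʷ v (suc m)) (trans (+-comm (length v) (m * length v)) (cong (_+ length v) (sym (length-^ʷ v m)))))
               lt)

  HasPeriod⇒^ʷ : ∀ {d} c (x : Word k) → 0 < d → length x ≡ c * d → HasPeriod d x → x ≡ take d x ^ʷ c
  HasPeriod⇒^ʷ zero    x _   |x|≡0 _  = length≡0⇒[] x |x|≡0
  HasPeriod⇒^ʷ {d} (suc c) x d>0 |x|≡ Pd =
    HasPeriod-ext x (u ^ʷ suc c) d>0 (trans |x|≡ (sym |uᶜ|)) Pd
      (subst (λ e → HasPeriod e (u ^ʷ suc c)) |u|≡d (HasPeriod-^ʷ u (suc c)))
      (sym (trans (cong (λ e → take e (u ^ʷ suc c)) (sym |u|≡d)) (take-length-++ u (u ^ʷ c))))
    where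
      u = take d x
      |u|≡d : length u ≡ d
      |u|≡d = length-take-≤ d x (subst (d ≤_) (sym |x|≡) (m≤m+n d (c * d)))
      |uᶜ| : length (u ^ʷ suc c) ≡ suc c * d
      |uᶜ| = trans (length-^ʷ u (suc c)) (cong (suc c *_) |u|≡d)

  ^ʷ-conjugate : ∀ (α β : Word k) s → β ++ (α ++ β) ^ʷ s ≡ (β ++ α) ^ʷ s ++ β
  ^ʷ-conjugate α β zero    = ++-identityʳ β
  ^ʷ-conjugate α β (suc s) = begin
      β ++ ((α ++ β) ++ (α ++ β) ^ʷ s)   ≡⟨ sym (++-assoc β (α ++ β) _) ⟩
      (β ++ (α ++ β)) ++ (α ++ β) ^ʷ s   ≡⟨ cong (_++ (α ++ β) ^ʷ s) (sym (++-assoc β α β)) ⟩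
      ((β ++ α) ++ β) ++ (α ++ β) ^ʷ s   ≡⟨ ++-assoc (β ++ α) β _ ⟩
      (β ++ α) ++ (β ++ (α ++ β) ^ʷ s)   ≡⟨ cong ((β ++ α) ++_) (^ʷ-conjugate α β s) ⟩
      (β ++ α) ++ ((β ++ α) ^ʷ s ++ β)   ≡⟨ sym (++-assoc (β ++ α) _ β) ⟩
      ((β ++ α) ++ (β ++ α) ^ʷ s) ++ β   ∎
    where open ≡-Reasoning

  ^ʷ-split : ∀ (α β : Word k) t s → ((β ++ α) ^ʷ t ++ β) ++ ((α ++ β) ^ʷ s ++ α) ≡ (β ++ α) ^ʷ (t + suc s)
  ^ʷ-split α β t s = begin
      (z ^ʷ t ++ β) ++ ((α ++ β) ^ʷ s ++ α) ≡⟨ ++-assoc (z ^ʷ t) β _ ⟩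
      z ^ʷ t ++ (β ++ ((α ++ β) ^ʷ s ++ α)) ≡⟨ cong (z ^ʷ t ++_) (sym (++-assoc β _ α)) ⟩
      z ^ʷ t ++ ((β ++ (α ++ β) ^ʷ s) ++ α) ≡⟨ cong (λ u → z ^ʷ t ++ (u ++ α)) (^ʷ-conjugate α β s) ⟩
      z ^ʷ t ++ ((z ^ʷ s ++ β) ++ α)        ≡⟨ cong (z ^ʷ t ++_) (++-assoc (z ^ʷ s) β α) ⟩
      z ^ʷ t ++ z ^ʷ s ++ z                 ≡⟨ cong (z ^ʷ t ++_) (sym (^ʷ-suc z s)) ⟩
      z ^ʷ t ++ z ^ʷ suc s                  ≡⟨ sym (^ʷ-+ z t (suc s)) ⟩
      z ^ʷ (t + suc s)                      ∎
    where
      open ≡-Reasoning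
      z = β ++ α

  primitive-intro : ∀ {x : Word k} → x ≢ [] → (∀ v m → 2 ≤ m → x ≢ v ^ʷ m) → Primitive x
  primitive-intro {x} x≢[] no-power = x≢[] , exponent≡1
    where
      exponent≡1 : ∀ v m → 1 ≤ m → x ≡ v ^ʷ m → m ≡ 1
      exponent≡1 v (suc zero)    _ _  = refl
      exponent≡1 v (suc (suc m)) _ eq = ⊥-elim (no-power v (suc (suc m)) (s≤s (s≤s z≤n)) eq)

  ^ʷ-¬primitive : ∀ (v : Word k) {m} → 2 ≤ m → ¬ Primitive (v ^ʷ m)
  ^ʷ-¬primitive v {m} 2≤m (_ , exponent≡1) with exponent≡1 v m (≤-trans (s≤s z≤n) 2≤m) refl
  ... | refl with 2≤m
  ... | s≤s ()

  primitive⇒period≡length : ∀ {g} (x : Word k) → Primitive x → 0 < g → g ∣ length x → HasPeriod g x → g ≡ length x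
  primitive⇒period≡length x (x≢[] , _) _ (divides zero |x|≡0) _ = ⊥-elim (x≢[] (length≡0⇒[] x |x|≡0))
  primitive⇒period≡length {g} x (_ , exponent≡1) g>0 (divides (suc c) |x|≡) Pg
    with exponent≡1 (take g x) (suc c) (s≤s z≤n) (HasPeriod⇒^ʷ (suc c) x g>0 |x|≡ Pg)
  ... | refl = trans (sym (+-identityʳ g)) (sym |x|≡)

  root-length>0 : ∀ {w : Word k} v m → w ≢ [] → w ≡ v ^ʷ m → 0 < length v
  root-length>0 {w} v m w≢[] w≡vᵐ = n≢0⇒n>0 λ |v|≡0 →
    w≢[] (length≡0⇒[] w (trans (cong length w≡vᵐ) (trans (length-^ʷ v m) (trans (cong (m *_) |v|≡0) (*-zeroʳ m)))))

  -- x ++ y is a factor of (y ++ x) ++ (y ++ x), so a root of y ++ x gives a proper period of x ++ y.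
  primitive-++-comm : ∀ (x y : Word k) → Primitive (x ++ y) → Primitive (y ++ x)
  primitive-++-comm x y pxy@(xy≢[] , _) = primitive-intro yx≢[] no-root
    where
      n = length (x ++ y)
      yx≢[] : y ++ x ≢ []
      yx≢[] yx≡[] = xy≢[] (length≡0⇒[] (x ++ y) (trans (length-++-comm x y) (cong length yx≡[])))
      factor : take n (drop (length y) ((y ++ x) ++ (y ++ x))) ≡ x ++ y
      factor = begin
          take n (drop (length y) ((y ++ x) ++ y ++ x)) ≡⟨ cong (λ w → take n (drop (length y) w)) (++-assoc y x (y ++ x)) ⟩
          take n (drop (length y) (y ++ x ++ y ++ x))   ≡⟨ cong (take n) (drop-length-++ y (x ++ y ++ x)) ⟩
          take n (x ++ y ++ x)                          ≡⟨ cong (take n) (sym (++-assoc x y x)) ⟩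
          take n ((x ++ y) ++ x)                        ≡⟨ take-length-++ (x ++ y) x ⟩
          x ++ y                                        ∎
        where open ≡-Reasoning
      no-root : ∀ v m → 2 ≤ m → y ++ x ≢ v ^ʷ m
      no-root v m 2≤m yx≡vᵐ = <⇒≢ (*-monoˡ-< e {{>-nonZero e>0}} {1} {m} 2≤m) (trans (*-identityˡ e) (trans e≡n n≡me))
        where
          e = length v
          e>0 = root-length>0 v m yx≢[] yx≡vᵐ
          n≡me : n ≡ m * e
          n≡me = trans (length-++-comm x y) (trans (cong length yx≡vᵐ) (length-^ʷ v m))
          square : (y ++ x) ++ (y ++ x) ≡ v ^ʷ (m + m)
          square = trans (cong₂ _++_ yx≡vᵐ yx≡vᵐ) (sym (^ʷ-+ v m m))
          period : HasPeriod e (x ++ y)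
          period = subst (HasPeriod e) factor
                     (HasPeriod-take n _ (HasPeriod-drop (length y) _ (subst (HasPeriod e) (sym square) (HasPeriod-^ʷ v (m + m)))))
          e≡n : e ≡ n
          e≡n = primitive⇒period≡length (x ++ y) pxy e>0 (divides m n≡me) period

  IsDividingPeriod : Word k → ℕ → Set
  IsDividingPeriod x d = 0 < d × d ∣ length x × HasPeriod d x

  -- The least dividing period is the length of a primitive root.
  primitive-root : ∀ (x : Word k) → x ≢ [] → ¬ Primitive x → ∃[ z ] ∃[ K ] Primitive z × 2 ≤ K × x ≡ z ^ʷ K
  primitive-root x x≢[] ¬prim
    with least-witness {IsDividingPeriod x} (λ d → 0 <? d ×-dec d ∣? length x ×-dec HasPeriod? Fin._≟_ d x)
                       (≢[]⇒length>0 x x≢[] , ∣-refl , λ i lt → ⊥-elim (m+n≮n i (length x) lt))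
  ... | d , (d>0 , divides K |x|≡Kd , Pd) , below = z , K , pz , 2≤K K x≡zᴷ |x|≡Kd , x≡zᴷ
    where
      z = take d x
      x≡zᴷ : x ≡ z ^ʷ K
      x≡zᴷ = HasPeriod⇒^ʷ K x d>0 |x|≡Kd Pd
      |z|≡d : length z ≡ d
      |z|≡d = length-take-≤ d x (∣⇒≤′ (≢[]⇒length>0 x x≢[]) (divides K |x|≡Kd))
      z≢[] : z ≢ []
      z≢[] z≡[] = <⇒≢ d>0 (sym (trans (sym |z|≡d) (cong length z≡[])))
      pz : Primitive z
      pz = primitive-intro z≢[] no-root
        where
          no-root : ∀ v j → 2 ≤ j → z ≢ v ^ʷ j
          no-root v j 2≤j z≡vʲ =
            below (length v) |v|<d (|v|>0 , divides (K * j) |x|≡ , subst (HasPeriod (length v)) (sym x≡vᴷʲ) (HasPeriod-^ʷ v (K * j)))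
            where
              |z|≡j|v| : length z ≡ j * length v
              |z|≡j|v| = trans (cong length z≡vʲ) (length-^ʷ v j)
              |v|>0 : 0 < length v
              |v|>0 = root-length>0 v j z≢[] z≡vʲ
              |v|<d : length v < d
              |v|<d = subst₂ _<_ (*-identityˡ (length v)) (trans (sym |z|≡j|v|) |z|≡d)
                        (*-monoˡ-< (length v) {{>-nonZero |v|>0}} {1} {j} 2≤j)
              x≡vᴷʲ : x ≡ v ^ʷ (K * j)
              x≡vᴷʲ = trans x≡zᴷ (trans (cong (_^ʷ K) z≡vʲ) (sym (^ʷ-* v K j)))
              |x|≡ : length x ≡ K * j * length v
              |x|≡ = trans (cong length x≡vᴷʲ) (length-^ʷ v (K * j))
      2≤K : ∀ K → x ≡ z ^ʷ K → length x ≡ K * d → 2 ≤ K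
      2≤K zero          _    |x|≡0 = ⊥-elim (x≢[] (length≡0⇒[] x |x|≡0))
      2≤K (suc zero)    x≡z¹ _     = ⊥-elim (¬prim (subst Primitive (sym (trans x≡z¹ (++-identityʳ z))) pz))
      2≤K (suc (suc _)) _    _     = s≤s (s≤s z≤n)

  primitive-prefix-period-∣ : ∀ {e} (y w : Word k) → Primitive y → take (length y) w ≡ y → 0 < e →
                              HasPeriod (length y) w → HasPeriod e w → length y + e ≤ length w + gcd (length y) e →
                              length y ∣ e
  primitive-prefix-period-∣ {e} y w py prefix e>0 Py Pe bound = subst (_∣ e) g≡|y| (gcd[m,n]∣n (length y) e)
    where
      |y|>0 = ≢[]⇒length>0 y (proj₁ py)
      g≡|y| : gcd (length y) e ≡ length y
      g≡|y| = primitive⇒period≡length y py (gcd>0 _ e |y|>0) (gcd[m,n]∣m (length y) e)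
                (subst (HasPeriod _) prefix (HasPeriod-take (length y) w (fine-wilf w |y|>0 e>0 Py Pe bound)))

  primitive-root-exponent-∣ : ∀ {K m} (z v : Word k) → Primitive z → 1 ≤ K → z ^ʷ K ≡ v ^ʷ m → m ∣ K
  primitive-root-exponent-∣ {suc K} {m} z v pz _ w≡vᵐ = divides c K≡cm
    where
      w = z ^ʷ suc K
      d = length z
      d>0 = ≢[]⇒length>0 z (proj₁ pz)
      |w|≡Kd : length w ≡ suc K * d
      |w|≡Kd = length-^ʷ z (suc K)
      |w|≡m|v| : length w ≡ m * length v
      |w|≡m|v| = trans (cong length w≡vᵐ) (length-^ʷ v m)
      |w|>0 : 0 < length w
      |w|>0 = subst (0 <_) (sym |w|≡Kd) (≤-trans d>0 (m≤m+n d (K * d)))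
      d∣|v| : d ∣ length v
      d∣|v| = primitive-prefix-period-∣ z w pz (take-length-++ z (z ^ʷ K)) (root-length>0 v m (length>0⇒≢[] w |w|>0) w≡vᵐ)
                (HasPeriod-^ʷ z (suc K)) (subst (HasPeriod (length v)) (sym w≡vᵐ) (HasPeriod-^ʷ v m))
                (divisors-bound |w|>0 (divides (suc K) |w|≡Kd) (divides m |w|≡m|v|))
      c = quotient d∣|v|
      K≡cm : suc K ≡ c * m
      K≡cm = *-cancelʳ-≡ (suc K) (c * m) d {{>-nonZero d>0}} (begin
          suc K * d    ≡⟨ sym |w|≡Kd ⟩
          length w     ≡⟨ |w|≡m|v| ⟩
          m * length v ≡⟨ cong (m *_) (_∣_.equality d∣|v|) ⟩
          m * (c * d)  ≡⟨ sym (*-assoc m c d) ⟩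
          m * c * d    ≡⟨ cong (_* d) (*-comm m c) ⟩
          c * m * d    ∎)
        where open ≡-Reasoning

  length-^ʷ-++ : ∀ (y u : Word k) t → length (y ^ʷ t ++ u) ≡ t * length y + length u
  length-^ʷ-++ y u t = trans (length-++ (y ^ʷ t)) (cong (_+ length u) (length-^ʷ y t))

  primitive-^ʷ-++ : ∀ (u v : Word k) {t} → Primitive (u ++ v) → 1 ≤ t → u ≢ [] → v ≢ [] →
                    FineWilfBound (length (u ++ v)) (length ((u ++ v) ^ʷ t ++ u)) → Primitive ((u ++ v) ^ʷ t ++ u)
  primitive-^ʷ-++ u v {suc t} py _ u≢[] v≢[] bound = primitive-intro x≢[] no-root
    where
      y = u ++ v
      x = y ^ʷ suc t ++ u
      d = length y
      |u|>0 = ≢[]⇒length>0 u u≢[]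
      |u|<d : length u < d
      |u|<d = subst (length u <_) (sym (length-++ u)) (m<m+n (length u) (≢[]⇒length>0 v v≢[]))
      x≢[] : x ≢ []
      x≢[] = length>0⇒≢[] x (subst (0 <_) (sym (length-^ʷ-++ y u (suc t))) (≤-trans |u|>0 (m≤n+m _ _)))
      Px : HasPeriod d x
      Px = subst (HasPeriod d) (take-length-++ x v)
             (HasPeriod-take (length x) (x ++ v)
               (subst (HasPeriod d) (sym (trans (++-assoc (y ^ʷ suc t) u v) (sym (^ʷ-suc y (suc t)))))
                 (HasPeriod-^ʷ y (suc (suc t)))))
      prefix : take d x ≡ y
      prefix = trans (cong (take d) (++-assoc y (y ^ʷ t) u)) (take-length-++ y (y ^ʷ t ++ u))
      no-root : ∀ w m → 2 ≤ m → x ≢ w ^ʷ m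
      no-root w m 2≤m x≡wᵐ = ¬d∣c*d+r {suc t} |u|>0 |u|<d (subst (d ∣_) (length-^ʷ-++ y u (suc t)) (∣-trans d∣|w| (divides m |x|≡m|w|)))
        where
          |x|≡m|w| : length x ≡ m * length w
          |x|≡m|w| = trans (cong length x≡wᵐ) (length-^ʷ w m)
          |w|>0 : 0 < length w
          |w|>0 = root-length>0 w m x≢[] x≡wᵐ
          d∣|w| : d ∣ length w
          d∣|w| = primitive-prefix-period-∣ y x py prefix |w|>0 Px (subst (HasPeriod (length w)) (sym x≡wᵐ) (HasPeriod-^ʷ w m))
                    (bound 2≤m (sym |x|≡m|w|))

  -- The concatenations pq for (p, q) ∈ 𝓔₂

  Cube : Word k → Set
  Cube w = ∃[ u ] w ≡ u ^ʷ 3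

  PrimitiveSquare : Word k → Set
  PrimitiveSquare w = ∃[ z ] Primitive z × w ≡ z ^ʷ 2

  E₂Word : ℕ → Word k → Set
  E₂Word l w = length w ≡ 3 * l × ¬ Primitive w × ¬ Cube w × ¬ PrimitiveSquare w

  InE₂-intro : ∀ {l} (α β : Word k) s t → Primitive (β ++ α) → α ≢ [] → β ≢ [] → 1 ≤ s →
               length ((β ++ α) ^ʷ t ++ β) ≡ 2 * l → length ((α ++ β) ^ʷ s ++ α) ≡ l →
               FineWilfBound (length (α ++ β)) l →
               (t ≡ 2 * s × length β ≡ 2 * length α) ⊎ (t ≡ 2 * s + 1 × length α ≡ 2 * length β) →
               let w = (β ++ α) ^ʷ (t + suc s) in InE₂ k l (take (2 * l) w , drop (2 * l) w)
  InE₂-intro {l} α β s t pz α≢[] β≢[] 1≤s |p|≡2l |q|≡l bound shape =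
    subst (InE₂ k l) (sym (trans (cong (λ w → take (2 * l) w , drop (2 * l) w) (sym (^ʷ-split α β t s)))
                                 (take-drop-++ p q |p|≡2l)))
      ((pp , pq , |p|≡2l , |q|≡l , ¬ppq) , α , β , s , α≢[] , β≢[] , 1≤s , py , refl ,
       Sum.map (λ (t≡ , |β|≡) → cong (λ t → (β ++ α) ^ʷ t ++ β) t≡ , |β|≡)
               (λ (t≡ , |α|≡) → cong (λ t → (β ++ α) ^ʷ t ++ β) t≡ , |α|≡) shape)
    where
      p = (β ++ α) ^ʷ t ++ β
      q = (α ++ β) ^ʷ s ++ α
      py : Primitive (α ++ β)
      py = primitive-++-comm β α pz
      1≤t : 1 ≤ t
      1≤t = [ (λ { (refl , _) → ≤-trans 1≤s (m≤m+n s (s + 0)) }) , (λ { (refl , _) → m≤n+m 1 (2 * s) }) ]′ shape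
      d≤l : length (β ++ α) ≤ l
      d≤l = subst₂ _≤_ (length-++-comm α β) (trans (sym (length-^ʷ-++ (α ++ β) α s)) |q|≡l)
              (≤-trans (subst (_≤ s * length (α ++ β)) (*-identityˡ _) (*-monoˡ-≤ (length (α ++ β)) 1≤s)) (m≤m+n _ _))
      pp : Primitive p
      pp = primitive-^ʷ-++ β α pz 1≤t β≢[] α≢[] (FineWilfBound-half (subst (2 * length (β ++ α) ≤_) (sym |p|≡2l) (*-monoʳ-≤ 2 d≤l)))
      pq : Primitive q
      pq = primitive-^ʷ-++ α β py 1≤s α≢[] β≢[] (subst (FineWilfBound _) (sym |q|≡l) bound)
      ¬ppq : ¬ Primitive (p ++ q)
      ¬ppq = subst (λ w → ¬ Primitive w) (sym (^ʷ-split α β t s)) (^ʷ-¬primitive (β ++ α) (≤-trans (s≤s 1≤s) (m≤n+m (suc s) t)))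

  InE₂-of-root : ∀ {l} (z : Word k) b c s t → Primitive z → 0 < b → 0 < c → length z ≡ b + c → 1 ≤ s →
                 t * (b + c) + b ≡ 2 * l → s * (b + c) + c ≡ l → FineWilfBound (b + c) l →
                 (t ≡ 2 * s × b ≡ 2 * c) ⊎ (t ≡ 2 * s + 1 × c ≡ 2 * b) →
                 let w = z ^ʷ (t + suc s) in InE₂ k l (take (2 * l) w , drop (2 * l) w)
  InE₂-of-root {l} z b c s t pz b>0 c>0 |z|≡b+c 1≤s |p|≡2l |q|≡l bound shape =
    subst (λ z → let w = z ^ʷ (t + suc s) in InE₂ k l (take (2 * l) w , drop (2 * l) w)) (take++drop≡id b z)
      (InE₂-intro α β s t (subst Primitive (sym (take++drop≡id b z)) pz) α≢[] β≢[] 1≤s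
        (trans (length-^ʷ-++ (β ++ α) β t) (trans (cong₂ (λ d e → t * d + e) |βα| |β|) |p|≡2l))
        (trans (length-^ʷ-++ (α ++ β) α s) (trans (cong₂ (λ d e → s * d + e) |αβ| |α|) |q|≡l))
        (subst (λ d → FineWilfBound d l) (sym |αβ|) bound)
        (Sum.map (map₂ λ b≡2c → trans |β| (trans b≡2c (cong (2 *_) (sym |α|))))
                 (map₂ λ c≡2b → trans |α| (trans c≡2b (cong (2 *_) (sym |β|)))) shape))
    where
      β = take b z
      α = drop b z
      |β| : length β ≡ b
      |β| = length-take-≤ b z (subst (b ≤_) (sym |z|≡b+c) (m≤m+n b c))
      |α| : length α ≡ c
      |α| = trans (length-drop b z) (trans (cong (_∸ b) |z|≡b+c) (m+n∸m≡n b c))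
      |βα| : length (β ++ α) ≡ b + c
      |βα| = trans (length-++ β) (cong₂ _+_ |β| |α|)
      |αβ| : length (α ++ β) ≡ b + c
      |αβ| = trans (length-++-comm α β) |βα|
      α≢[] : α ≢ []
      α≢[] = length>0⇒≢[] α (subst (0 <_) (sym |α|) c>0)
      β≢[] : β ≢ []
      β≢[] = length>0⇒≢[] β (subst (0 <_) (sym |β|) b>0)

  InE₂-of-power : ∀ {l K} (z : Word k) → Primitive z → 2 ≤ K → ¬ 3 ∣ K → K ≢ 2 → K * length z ≡ 3 * l →
                  InE₂ k l (take (2 * l) (z ^ʷ K) , drop (2 * l) (z ^ʷ K))
  InE₂-of-power {l} {K} z pz 2≤K ¬3∣K K≢2 K|z|≡3l with exponent≡3s+1⊎3s+2 2≤K ¬3∣K K≢2 | 3∣cofactor {l = l} ¬3∣K K|z|≡3l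
  ... | s , 1≤s , inj₁ refl | divides a |z|≡a3 =
    subst (λ K → InE₂ k l (take (2 * l) (z ^ʷ K) , drop (2 * l) (z ^ʷ K))) (exponent s)
      (InE₂-of-root z (2 * a) a s (2 * s) pz (≤-trans a>0 (m≤m+n a (a + 0))) a>0 (trans |z|≡a3 (thirds a)) 1≤s
        (trans (|p| s a) (cong (2 *_) (sym l≡))) (trans (|q| s a) (sym l≡))
        (subst₂ FineWilfBound (thirds′ a) (sym l≡) (FineWilfBound[3a,[3s+1]a] a 1≤s)) (inj₁ (refl , refl)))
    where
      a>0 : 0 < a
      a>0 = n≢0⇒n>0 λ a≡0 → proj₁ pz (length≡0⇒[] z (trans |z|≡a3 (cong (_* 3) a≡0)))
      l≡ : l ≡ (3 * s + 1) * a
      l≡ = *-cancelˡ-≡ l _ 3 (trans (sym K|z|≡3l) (trans (cong ((3 * s + 1) *_) |z|≡a3) (regroup s a)))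
        where
          regroup : ∀ s a → (3 * s + 1) * (a * 3) ≡ 3 * ((3 * s + 1) * a)
          regroup = solve-∀
      exponent : ∀ s → 2 * s + suc s ≡ 3 * s + 1
      exponent = solve-∀
      thirds : ∀ a → a * 3 ≡ 2 * a + a
      thirds = solve-∀
      thirds′ : ∀ a → 3 * a ≡ 2 * a + a
      thirds′ = solve-∀
      |p| : ∀ s a → 2 * s * (2 * a + a) + 2 * a ≡ 2 * ((3 * s + 1) * a)
      |p| = solve-∀
      |q| : ∀ s a → s * (2 * a + a) + a ≡ (3 * s + 1) * a
      |q| = solve-∀
  ... | s , 1≤s , inj₂ refl | divides a |z|≡a3 =
    subst (λ K → InE₂ k l (take (2 * l) (z ^ʷ K) , drop (2 * l) (z ^ʷ K))) (exponent s)
      (InE₂-of-root z a (2 * a) s (2 * s + 1) pz a>0 (≤-trans a>0 (m≤m+n a (a + 0))) (trans |z|≡a3 (thirds a)) 1≤s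
        (trans (|p| s a) (cong (2 *_) (sym l≡))) (trans (|q| s a) (sym l≡))
        (subst₂ FineWilfBound (thirds′ a) (sym l≡) (FineWilfBound[3a,[3s+2]a] a 1≤s)) (inj₂ (refl , refl)))
    where
      a>0 : 0 < a
      a>0 = n≢0⇒n>0 λ a≡0 → proj₁ pz (length≡0⇒[] z (trans |z|≡a3 (cong (_* 3) a≡0)))
      l≡ : l ≡ (3 * s + 2) * a
      l≡ = *-cancelˡ-≡ l _ 3 (trans (sym K|z|≡3l) (trans (cong ((3 * s + 2) *_) |z|≡a3) (regroup s a)))
        where
          regroup : ∀ s a → (3 * s + 2) * (a * 3) ≡ 3 * ((3 * s + 2) * a)
          regroup = solve-∀
      exponent : ∀ s → 2 * s + 1 + suc s ≡ 3 * s + 2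
      exponent = solve-∀
      thirds : ∀ a → a * 3 ≡ a + 2 * a
      thirds = solve-∀
      thirds′ : ∀ a → 3 * a ≡ a + 2 * a
      thirds′ = solve-∀
      |p| : ∀ s a → (2 * s + 1) * (a + 2 * a) + a ≡ 2 * ((3 * s + 2) * a)
      |p| = solve-∀
      |q| : ∀ s a → s * (a + 2 * a) + 2 * a ≡ (3 * s + 2) * a
      |q| = solve-∀

  E₂Word⇒InE₂ : ∀ {l} (w : Word k) → 0 < l → E₂Word l w → InE₂ k l (take (2 * l) w , drop (2 * l) w)
  E₂Word⇒InE₂ {l} w l>0 (|w|≡3l , ¬prim , ¬cube , ¬psq)
    with primitive-root w (length>0⇒≢[] w (subst (0 <_) (sym |w|≡3l) (≤-trans l>0 (m≤m+n l _)))) ¬prim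
  ... | z , K , pz , 2≤K , refl = InE₂-of-power z pz 2≤K ¬3∣K K≢2 (trans (sym (length-^ʷ z K)) |w|≡3l)
    where
      ¬3∣K : ¬ 3 ∣ K
      ¬3∣K (divides c refl) = ¬cube (z ^ʷ c , trans (cong (z ^ʷ_) (*-comm c 3)) (^ʷ-* z 3 c))
      K≢2 : K ≢ 2
      K≢2 refl = ¬psq (z , pz , refl)

  InE₂⇒power : ∀ {l p q} → InE₂ k l (p , q) → ∃[ z ] ∃[ K ] Primitive z × ¬ 3 ∣ K × 2 < K × p ++ q ≡ z ^ʷ K
  InE₂⇒power (_ , α , β , s , _ , _ , 1≤s , py , refl , inj₁ (refl , _)) =
    β ++ α , 2 * s + suc s , primitive-++-comm α β py ,
    subst (λ K → ¬ 3 ∣ K) (sym (exponent s)) (¬3∣3s+r s (s≤s z≤n) (s≤s (s≤s z≤n))) ,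
    +-mono-≤ (≤-trans 1≤s (m≤m+n s (s + 0))) (s≤s 1≤s) , ^ʷ-split α β (2 * s) s
    where
      exponent : ∀ s → 2 * s + suc s ≡ 3 * s + 1
      exponent = solve-∀
  InE₂⇒power (_ , α , β , s , _ , _ , 1≤s , py , refl , inj₂ (refl , _)) =
    β ++ α , 2 * s + 1 + suc s , primitive-++-comm α β py ,
    subst (λ K → ¬ 3 ∣ K) (sym (exponent s)) (¬3∣3s+r s (s≤s z≤n) (s≤s (s≤s (s≤s z≤n)))) ,
    +-mono-≤ (m≤n+m 1 (2 * s)) (s≤s 1≤s) , ^ʷ-split α β (2 * s + 1) s
    where
      exponent : ∀ s → 2 * s + 1 + suc s ≡ 3 * s + 2
      exponent = solve-∀

  InE₂⇒E₂Word : ∀ {l p q} → InE₂ k l (p , q) → E₂Word l (p ++ q)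
  InE₂⇒E₂Word {l} {p} {q} e₂@((_ , _ , |p|≡2l , |q|≡l , ¬prim) , _) with InE₂⇒power e₂
  ... | z , K , pz , ¬3∣K , 2<K , pq≡zᴷ = |pq|≡3l , ¬prim , ¬cube , ¬psq
    where
      |pq|≡3l : length (p ++ q) ≡ 3 * l
      |pq|≡3l = trans (length-++ p) (trans (cong₂ _+_ |p|≡2l |q|≡l) (+-comm (2 * l) l))
      ¬cube : ¬ Cube (p ++ q)
      ¬cube (u , pq≡u³) = ¬3∣K (primitive-root-exponent-∣ z u pz (≤-trans (s≤s z≤n) (<⇒≤ 2<K)) (trans (sym pq≡zᴷ) pq≡u³))
      ¬psq : ¬ PrimitiveSquare (p ++ q)
      ¬psq (y , py , pq≡y²) = <⇒≱ 2<K (∣⇒≤′ (s≤s z≤n) (primitive-root-exponent-∣ y z py (s≤s z≤n) (trans (sym pq≡y²) pq≡zᴷ)))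

-- Counting

module _ {A : Set} where

  same-elements⇒length≡ : ∀ {xs ys : List A} → Unique xs → Unique ys → (∀ x → x ∈ xs ⇔ x ∈ ys) → length xs ≡ length ys
  same-elements⇒length≡ uxs uys same = ↭-length (∼bag⇒↭ (unique∧set⇒bag uxs uys (λ {x} → same x)))

  length-filter+∁ : ∀ {P : A → Set} (P? : Decidable P) xs → length (filter P? xs) + length (filter (∁? P?) xs) ≡ length xs
  length-filter+∁ P? []       = refl
  length-filter+∁ P? (x ∷ xs) with P? x
  ... | yes _ = cong suc (length-filter+∁ P? xs)
  ... | no  _ = trans (+-suc _ _) (cong suc (length-filter+∁ P? xs))

  IsCard-⇔ : ∀ {P Q : A → Set} {c} → (∀ x → P x ⇔ Q x) → IsCard P c → IsCard Q c
  IsCard-⇔ P⇔Q (xs , uxs , mem , len) = xs , uxs , (λ x → P⇔Q x ⇔-∘ mem x) , len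

  IsCard-∖ : ∀ {P Q : A → Set} {a b} → DecidableEquality A → (∀ x → Q x → P x) →
             IsCard P a → IsCard Q b → IsCard (λ x → P x × ¬ Q x) (a ∸ b)
  IsCard-∖ {P} {Q} {a} {b} _≟_ Q⊆P (xs , uxs , memx , refl) (ys , uys , memy , refl) =
    filter (∁? ∈ys?) xs , Unique.filter⁺ (∁? ∈ys?) uxs , mem , length-rest
    where
      ∈ys? : Decidable (_∈ ys)
      ∈ys? x = DecMembership._∈?_ _≟_ x ys
      open Equivalence
      mem : ∀ x → x ∈ filter (∁? ∈ys?) xs ⇔ (P x × ¬ Q x)
      mem x = mk⇔ (λ m → let (x∈xs , x∉ys) = ∈-filter⁻ (∁? ∈ys?) m in to (memx x) x∈xs , λ Qx → x∉ys (from (memy x) Qx))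
                  (λ (Px , ¬Qx) → ∈-filter⁺ (∁? ∈ys?) (from (memx x) Px) (λ x∈ys → ¬Qx (to (memy x) x∈ys)))
      common : length (filter ∈ys? xs) ≡ length ys
      common = same-elements⇒length≡ (Unique.filter⁺ ∈ys? uxs) uys λ x →
        mk⇔ (λ m → proj₂ (∈-filter⁻ ∈ys? {xs = xs} m))
            (λ x∈ys → ∈-filter⁺ ∈ys? (from (memx x) (Q⊆P x (to (memy x) x∈ys))) x∈ys)
      length-rest : length (filter (∁? ∈ys?) xs) ≡ length xs ∸ length ys
      length-rest = trans (sym (m+n∸m≡n (length (filter ∈ys? xs)) _))
                          (cong₂ _∸_ (length-filter+∁ ∈ys? xs) common)

  IsCard-map : ∀ {B : Set} {P : A → Set} {Q : B → Set} {c} (f : A → B) → (∀ {x y} → f x ≡ f y → x ≡ y) →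
               (∀ y → (∃[ x ] P x × f x ≡ y) ⇔ Q y) → IsCard P c → IsCard Q c
  IsCard-map {Q = Q} f f-injective image (xs , uxs , mem , len) =
    map f xs , Unique.map⁺ f-injective uxs , mem′ , trans (length-map f xs) len
    where
      open Equivalence
      mem′ : ∀ y → y ∈ map f xs ⇔ Q y
      mem′ y = mk⇔ (λ m → let (x , x∈xs , y≡fx) = ∈-map⁻ f m in to (image y) (x , to (mem x) x∈xs , sym y≡fx))
                   (λ Qy → let (x , Px , fx≡y) = from (image y) Qy in subst (_∈ map f xs) fx≡y (∈-map⁺ f (from (mem x) Px)))

wordsOfLength : ∀ k → ℕ → List (Word k)
wordsOfLength k zero    = [] ∷ []
wordsOfLength k (suc N) = cartesianProductWith _∷_ (allFin k) (wordsOfLength k N)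

IsCard-wordsOfLength : ∀ k N → IsCard (λ (w : Word k) → length w ≡ N) (k ^ N)
IsCard-wordsOfLength k N = wordsOfLength k N , unique N , (λ w → mk⇔ (to N w) (from N w)) , length-words N
  where
    unique : ∀ N → Unique (wordsOfLength k N)
    unique zero    = All.[] AllPairs.∷ AllPairs.[]
    unique (suc N) = Unique.cartesianProductWith⁺ _∷_ (λ { refl → refl , refl }) (Unique.allFin⁺ k) (unique N)
    to : ∀ N w → w ∈ wordsOfLength k N → length w ≡ N
    to zero    .[] (here refl) = refl
    to (suc N) w m with ∈-cartesianProductWith⁻ _∷_ (allFin k) (wordsOfLength k N) m
    ... | _ , u , _ , u∈ , refl = cong suc (to N u u∈)
    from : ∀ N w → length w ≡ N → w ∈ wordsOfLength k N
    from zero    []      _   = here refl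
    from (suc N) (c ∷ u) len = ∈-cartesianProductWith⁺ _∷_ (∈-allFin c) (from N u (suc-injective len))
    length-product : ∀ {B C D : Set} (f : B → C → D) xs ys → length (cartesianProductWith f xs ys) ≡ length xs * length ys
    length-product f []       ys = refl
    length-product f (x ∷ xs) ys = trans (length-++ (map (f x) ys)) (cong₂ _+_ (length-map (f x) ys) (length-product f xs ys))
    length-words : ∀ N → length (wordsOfLength k N) ≡ k ^ N
    length-words zero    = refl
    length-words (suc N) = trans (length-product _∷_ (allFin k) (wordsOfLength k N))
                                 (cong₂ _*_ (length-tabulate {A = Fin k} (λ i → i)) (length-words N))

module _ {k : ℕ} (l : ℕ) where

  private
    _≟ʷ_ : DecidableEquality (Word k)
    _≟ʷ_ = ≡-dec Fin._≟_

    length-root : ∀ {w u : Word k} {c K} → length w ≡ suc K * c → w ≡ u ^ʷ suc K → length u ≡ c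
    length-root {w} {u} {c} {K} |w|≡ w≡uᴷ = *-cancelˡ-≡ (length u) c (suc K) (trans (sym (length-^ʷ u (suc K))) (trans (cong length (sym w≡uᴷ)) |w|≡))

  IsCard-non-primitive-non-cube : ∀ {a} → IsCard (PrimOfLength k (3 * l)) a →
      IsCard (λ (w : Word k) → length w ≡ 3 * l × ¬ Primitive w × ¬ Cube w) (k ^ (3 * l) ∸ k ^ l ∸ a)
  IsCard-non-primitive-non-cube prims =
    IsCard-⇔ reassociate (IsCard-∖ _≟ʷ_ primitive⊆ (IsCard-∖ _≟ʷ_ cube⊆ (IsCard-wordsOfLength k (3 * l)) cubes) prims)
    where
      cubes : IsCard (λ w → ∃[ u ] length u ≡ l × u ^ʷ 3 ≡ w) (k ^ l)
      cubes = IsCard-map (_^ʷ 3) (^ʷ-injective 2) (λ _ → mk⇔ id id) (IsCard-wordsOfLength k l)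
      cube⊆ : ∀ w → (∃[ u ] length u ≡ l × u ^ʷ 3 ≡ w) → length w ≡ 3 * l
      cube⊆ _ (u , |u|≡l , refl) = trans (length-^ʷ u 3) (cong (3 *_) |u|≡l)
      primitive⊆ : ∀ w → PrimOfLength k (3 * l) w → length w ≡ 3 * l × ¬ (∃[ u ] length u ≡ l × u ^ʷ 3 ≡ w)
      primitive⊆ w (pw , |w|≡3l) = |w|≡3l , λ (u , _ , u³≡w) → ^ʷ-¬primitive u {3} (s≤s (s≤s z≤n)) (subst Primitive (sym u³≡w) pw)
      reassociate : ∀ w → ((length w ≡ 3 * l × ¬ (∃[ u ] length u ≡ l × u ^ʷ 3 ≡ w)) × ¬ PrimOfLength k (3 * l) w)
                        ⇔ (length w ≡ 3 * l × ¬ Primitive w × ¬ Cube w)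
      reassociate w = mk⇔
        (λ ((|w|≡3l , ¬cube) , ¬prim) → |w|≡3l , (λ pw → ¬prim (pw , |w|≡3l)) ,
                                          λ (u , w≡u³) → ¬cube (u , length-root {u = u} {K = 2} |w|≡3l w≡u³ , sym w≡u³))
        (λ (|w|≡3l , ¬prim , ¬cube) → (|w|≡3l , λ (u , _ , u³≡w) → ¬cube (u , sym u³≡w)) , λ (pw , _) → ¬prim pw)

  IsCard-E₂Word-odd : ∀ {a} → (∀ h → 2 * h ≢ 3 * l) → IsCard (PrimOfLength k (3 * l)) a →
                      IsCard (E₂Word l) (k ^ (3 * l) ∸ k ^ l ∸ a)
  IsCard-E₂Word-odd odd prims = IsCard-⇔ (λ w → mk⇔
      (λ (|w|≡3l , ¬prim , ¬cube) → |w|≡3l , ¬prim , ¬cube ,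
         λ (z , _ , w≡z²) → odd (length z) (trans (sym (length-^ʷ z 2)) (trans (cong length (sym w≡z²)) |w|≡3l)))
      (λ (|w|≡3l , ¬prim , ¬cube , _) → |w|≡3l , ¬prim , ¬cube))
    (IsCard-non-primitive-non-cube prims)

  IsCard-E₂Word-even : ∀ {a b h} → 2 * h ≡ 3 * l → IsCard (PrimOfLength k (3 * l)) a → IsCard (PrimOfLength k h) b →
                       IsCard (E₂Word l) (k ^ (3 * l) ∸ k ^ l ∸ a ∸ b)
  IsCard-E₂Word-even {h = h} 2h≡3l prims half-prims =
    IsCard-⇔ reassociate (IsCard-∖ _≟ʷ_ square⊆ (IsCard-non-primitive-non-cube prims) squares)
    where
      squares : IsCard (λ w → ∃[ z ] PrimOfLength k h z × z ^ʷ 2 ≡ w) _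
      squares = IsCard-map (_^ʷ 2) (^ʷ-injective 1) (λ _ → mk⇔ id id) half-prims
      square⊆ : ∀ w → (∃[ z ] PrimOfLength k h z × z ^ʷ 2 ≡ w) → length w ≡ 3 * l × ¬ Primitive w × ¬ Cube w
      square⊆ _ (z , (pz , |z|≡h) , refl) =
        trans (length-^ʷ z 2) (trans (cong (2 *_) |z|≡h) 2h≡3l) , ^ʷ-¬primitive z {2} (s≤s (s≤s z≤n)) ,
        λ (u , z²≡u³) → from-no (3 ∣? 2) (primitive-root-exponent-∣ z u pz (s≤s z≤n) z²≡u³)
      reassociate : ∀ w → ((length w ≡ 3 * l × ¬ Primitive w × ¬ Cube w) × ¬ (∃[ z ] PrimOfLength k h z × z ^ʷ 2 ≡ w))
                        ⇔ E₂Word l w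
      reassociate w = mk⇔
        (λ ((|w|≡3l , ¬prim , ¬cube) , ¬square) → |w|≡3l , ¬prim , ¬cube ,
           λ (z , pz , w≡z²) → ¬square (z , (pz , length-root {u = z} {K = 1} (trans |w|≡3l (sym 2h≡3l)) w≡z²) , sym w≡z²))
        (λ (|w|≡3l , ¬prim , ¬cube , ¬psq) → (|w|≡3l , ¬prim , ¬cube) , λ (z , (pz , _) , z²≡w) → ¬psq (z , pz , sym z²≡w))

  IsCard-InE₂ : ∀ {c} → 0 < l → IsCard (E₂Word l) c → IsCard (InE₂ k l) c
  IsCard-InE₂ l>0 = IsCard-map (λ w → take (2 * l) w , drop (2 * l) w) split-injective image
    where
      split-injective : ∀ {x y : Word k} → (take (2 * l) x , drop (2 * l) x) ≡ (take (2 * l) y , drop (2 * l) y) → x ≡ y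
      split-injective {x} {y} eq =
        trans (sym (take++drop≡id (2 * l) x)) (trans (cong (λ (p , q) → p ++ q) eq) (take++drop≡id (2 * l) y))
      image : ∀ pq → (∃[ w ] E₂Word l w × (take (2 * l) w , drop (2 * l) w) ≡ pq) ⇔ InE₂ k l pq
      image (p , q) = mk⇔ (λ (w , e , split≡pq) → subst (InE₂ k l) split≡pq (E₂Word⇒InE₂ w l>0 e))
                          (λ e₂@((_ , _ , |p|≡2l , _) , _) → p ++ q , InE₂⇒E₂Word e₂ , take-drop-++ p q |p|≡2l)

proposition3p10 : (n m l₁ : ℕ) → 2 ≤ n → 2 ≤ l₁ → gcd 3 l₁ ≡ 1 →
    (a : ℕ) → IsCard (PrimOfLength n (3 * (3 ^ m * l₁))) a →
    ((l₁ % 2 ≡ 1) → IsCard (InE₂ n (3 ^ m * l₁)) (n ^ (3 * (3 ^ m * l₁)) ∸ n ^ (3 ^ m * l₁) ∸ a))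
    × ((l₁ % 2 ≡ 0) → (b : ℕ) → IsCard (PrimOfLength n ((3 * (3 ^ m * l₁)) / 2)) b →
        IsCard (InE₂ n (3 ^ m * l₁)) (n ^ (3 * (3 ^ m * l₁)) ∸ n ^ (3 ^ m * l₁) ∸ a ∸ b))
proposition3p10 n m l₁ _ 2≤l₁ _ a prims = odd-case , even-case
  where
    l = 3 ^ m * l₁
    l>0 : 0 < l
    l>0 = *-mono-≤ (m^n>0 3 m) (≤-trans (s≤s z≤n) 2≤l₁)
    odd-case : l₁ % 2 ≡ 1 → IsCard (InE₂ n l) (n ^ (3 * l) ∸ n ^ l ∸ a)
    odd-case l₁-odd = IsCard-InE₂ l l>0 (IsCard-E₂Word-odd l (odd⇒≢2* (3 * l) 3l-odd) prims)
      where
        3l-odd : (3 * l) % 2 ≡ 1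
        3l-odd = odd-* 3 l refl (odd-* (3 ^ m) l₁ (odd-^ 3 m refl) l₁-odd)
    even-case : l₁ % 2 ≡ 0 → ∀ b → IsCard (PrimOfLength n ((3 * l) / 2)) b → IsCard (InE₂ n l) (n ^ (3 * l) ∸ n ^ l ∸ a ∸ b)
    even-case l₁-even b half-prims = IsCard-InE₂ l l>0 (IsCard-E₂Word-even l 2h≡3l prims half-prims)
      where
        2∣3l : 2 ∣ 3 * l
        2∣3l = ∣n⇒∣m*n 3 (∣n⇒∣m*n (3 ^ m) (m%n≡0⇒n∣m l₁ 2 l₁-even))
        2h≡3l : 2 * ((3 * l) / 2) ≡ 3 * l
        2h≡3l = trans (*-comm 2 ((3 * l) / 2)) (m/n*n≡m 2∣3l)
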